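{- Let $(G,\mathrm{col})$ be an instance of Free-Flood-It and let $x,y\in V(G)$ be false twins (i.e., $N(x)=N(y)$) with $\mathrm{col}(x)=\mathrm{col}(y)$. A sequence of moves $(u_1,c_1),\ldots,(u_k,c_k)$ with $u_i\notin\{x,y\}$ for all $1\le i\le k$ results in a constant coloring when applied to $(G,\mathrm{col})$ if and only if it results in a constant coloring when applied to $(G-x,\mathrm{col}|_{G-x})$.
   Context: For a graph $G=(V,E)$ and a coloring $\mathrm{col}\colon V\to[c_{\max}]$, $\mathrm{Comp}(\mathrm{col},u)$ denotes the monochromatic connected component containing $u$ (maximal set of vertices of color $\mathrm{col}(u)$ reachable from $u$ by paths of vertices of that color). A move is a pair $(u,c)$ with $u\in V$ and $c\in[c_{\max}]$; its result is the coloring obtained by recoloring every vertex of $\mathrm{Comp}(\mathrm{col},u)$ with $c$, other vertices unchanged. Moves in a sequence are applied successively. $N(x)$ denotes the open neighborhood of $x$. -}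

module Defs where

open import Data.Nat using (ℕ; suc)
open import Data.Fin using (Fin; punchIn)
open import Data.Bool using (Bool; true; false)
open import Data.List using (List; []; _∷_; map)
open import Data.Product using (_×_; _,_; ∃; Σ)
open import Relation.Binary.PropositionalEquality using (_≡_)
open import Relation.Nullary using (¬_)

record Graph (n : ℕ) : Set where
  field
    adj   : Fin n → Fin n → Bool
    sym   : ∀ u v → adj u v ≡ adj v u
    irrefl : ∀ u → adj u u ≡ false
open Graph public

Coloring : ℕ → ℕ → Set
Coloring n cmax = Fin n → Fin cmax

data MonoReach {n cmax : ℕ} (G : Graph n) (col : Coloring n cmax) (u : Fin n) : Fin n → Set where
  here : MonoReach G col u u
  step : ∀ {v w} → MonoReach G col u v → adj G v w ≡ true → col w ≡ col u →
         MonoReach G col u w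

Comp : ∀ {n cmax} → Graph n → Coloring n cmax → Fin n → Fin n → Set
Comp G col u v = MonoReach G col u v

Move : ℕ → ℕ → Set
Move n cmax = Fin n × Fin cmax

MoveResult : ∀ {n cmax} → Graph n → Coloring n cmax → Move n cmax → Coloring n cmax → Set
MoveResult G col (u , c) col' =
  ∀ v → (Comp G col u v → col' v ≡ c) × (¬ Comp G col u v → col' v ≡ col v)

data SeqResult {n cmax : ℕ} (G : Graph n) : Coloring n cmax → List (Move n cmax) → Coloring n cmax → Set where
  done : ∀ {col} → SeqResult G col [] col
  next : ∀ {col col' col'' m ms} → MoveResult G col m col' →
         SeqResult G col' ms col'' → SeqResult G col (m ∷ ms) col''

Constant : ∀ {n cmax} → Coloring n cmax → Set
Constant {n} {cmax} col = ∃ λ (c : Fin cmax) → ∀ v → col v ≡ c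

ResultsConstant : ∀ {n cmax} → Graph n → Coloring n cmax → List (Move n cmax) → Set
ResultsConstant G col ms = ∃ λ col' → SeqResult G col ms col' × Constant col'

-- G - x : the induced subgraph on V ∖ {x}; its vertices Fin m are embedded
-- into Fin (suc m) via punchIn x.
deleteVertex : ∀ {m} → Graph (suc m) → Fin (suc m) → Graph m
deleteVertex G x = record
  { adj = λ i j → adj G (punchIn x i) (punchIn x j)
  ; sym = λ i j → sym G (punchIn x i) (punchIn x j)
  ; irrefl = λ i → irrefl G (punchIn x i)
  }

restrict : ∀ {m cmax} → Coloring (suc m) cmax → Fin (suc m) → Coloring m cmax
restrict col x i = col (punchIn x i)

liftMove : ∀ {m cmax} → Fin (suc m) → Move m cmax → Move (suc m) cmax
liftMove x (u , c) = (punchIn x u , c)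

module Submission where

-- Let x, y be false twins of G with col x ≡ col y, and write G' = G - x,
-- with vertices embedded into G by  punchIn x.  The map  collapse : V(G) → V(G')
-- sends x to (the copy of) y and every other vertex to itself.  Because x and y
-- have the same neighbourhood, collapse is a graph homomorphism, and so is
-- punchIn x in the other direction.  Monochromatic
-- reachability is transported along colour-preserving homomorphisms
-- (mapReach); the only loss is that a path of G' ending in y yields a path of
-- G ending in y rather than in x, which is repaired by the twin property
-- (reach-x-via-twin).
--
-- The invariant kept along a move sequence is  Lifts S T : S ≡ T ∘ collapse
-- pointwise.  A move avoiding x and y maps a lifted pair of colourings to a
-- lifted pair, in both directions (move-lift, move-restrict); the uniqueness of
-- move results (moveResult-unique) shows that the colouring of G produced by a
-- move is again a lift.  Induction over the sequence and the observation that
-- S is constant iff T is constant when S lifts T give the theorem.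

open import Defs hiding (sym)
open import Data.Nat using (ℕ; suc)
open import Data.Fin using (Fin; punchIn; punchOut)
open import Data.Fin.Properties using (punchIn-injective; punchInᵢ≢i; punchIn-punchOut; _≟_)
open import Data.Bool using (true)
open import Data.List using (List; []; _∷_; map)
open import Data.List.Relation.Unary.All using (All; []; _∷_)
open import Data.Product using (proj₁; proj₂; _,_; _×_; ∃)
open import Data.Sum using (_⊎_; inj₁; inj₂)
open import Data.Empty using (⊥-elim)
open import Function using (_∘_)
open import Function.Bundles using (_⇔_; mk⇔)
open import Relation.Nullary using (yes; no)
open import Relation.Nullary.Decidable using (decidable-stable; ¬¬-excluded-middle)
open import Relation.Binary.PropositionalEquality
  using (_≡_; _≢_; refl; sym; trans; cong; subst; module ≡-Reasoning)

mapReach : ∀ {n n' cmax} {G : Graph n} {H : Graph n'}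
           {S : Coloring n cmax} {T : Coloring n' cmax} (f : Fin n → Fin n') →
           (∀ a b → adj G a b ≡ true → adj H (f a) (f b) ≡ true) →
           (∀ a → T (f a) ≡ S a) →
           ∀ {u w} → MonoReach G S u w → MonoReach H T (f u) (f w)
mapReach f hom colour here = here
mapReach f hom colour {u} (step {v} {w} r e c) =
  step (mapReach f hom colour r) (hom v w e) (trans (colour w) (trans c (sym (colour u))))

-- The result of a move is unique pointwise.  Membership in a component need
-- not be decidable, but equality of colours is, so a double-negated case
-- split on membership suffices.
moveResult-unique : ∀ {n cmax} {G : Graph n} {col col' col'' : Coloring n cmax}
                    {mv : Move n cmax} →
                    MoveResult G col mv col' → MoveResult G col mv col'' →
                    ∀ v → col' v ≡ col'' v
moveResult-unique {col' = col'} {col''} r₁ r₂ v =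
  decidable-stable (col' v ≟ col'' v) λ ne → ¬¬-excluded-middle λ where
    (yes inC) → ne (trans (proj₁ (r₁ v) inC) (sym (proj₁ (r₂ v) inC)))
    (no ¬inC) → ne (trans (proj₂ (r₁ v) ¬inC) (sym (proj₂ (r₂ v) ¬inC)))

-- In a graph where x and y are false twins of the same colour, every
-- monochromatic path from u ≠ y ending in y can be redirected to end in x:
-- its last edge enters y from a neighbour of y, hence of x.
reach-x-via-twin : ∀ {n cmax} (G : Graph n) {S : Coloring n cmax} {x y u : Fin n} →
                   (∀ z → adj G x z ≡ adj G y z) → S x ≡ S y → u ≢ y →
                   MonoReach G S u y → MonoReach G S u x
reach-x-via-twin G tw sxy u≢y here = ⊥-elim (u≢y refl)
reach-x-via-twin G {x = x} {y} tw sxy u≢y (step {v} r e c) =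
  step r (trans adj-vx≡adj-vy e) (trans sxy c)
  where
    adj-vx≡adj-vy : adj G v x ≡ adj G v y
    adj-vx≡adj-vy = trans (Graph.sym G v x) (trans (tw v) (Graph.sym G y v))

module Deletion {m cmax : ℕ} (G : Graph (suc m)) (x y : Fin (suc m)) (x≢y : x ≢ y)
                (tw : ∀ z → adj G x z ≡ adj G y z) where

  G' : Graph m
  G' = deleteVertex G x

  embed : Fin m → Fin (suc m)
  embed = punchIn x

  y' : Fin m
  y' = punchOut x≢y

  collapse : Fin (suc m) → Fin m
  collapse v with x ≟ v
  ... | yes _ = y'
  ... | no x≢v = punchOut x≢v

  collapse-embed : ∀ i → collapse (embed i) ≡ i
  collapse-embed i with x ≟ embed i
  ... | yes x≡i = ⊥-elim (punchInᵢ≢i x i (sym x≡i))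
  ... | no x≢i = punchIn-injective x _ _ (punchIn-punchOut x≢i)

  embed-collapse : ∀ v → (v ≡ x × embed (collapse v) ≡ y) ⊎ embed (collapse v) ≡ v
  embed-collapse v with x ≟ v
  ... | yes refl = inj₁ (refl , punchIn-punchOut x≢y)
  ... | no x≢v = inj₂ (punchIn-punchOut x≢v)

  collapse-twins : collapse x ≡ collapse y
  collapse-twins with embed-collapse x
  ... | inj₁ (_ , x↦y) = trans (sym (collapse-embed (collapse x))) (cong collapse x↦y)
  ... | inj₂ x↦x = ⊥-elim (punchInᵢ≢i x (collapse x) x↦x)

  adj-recollapse : ∀ a b → adj G (embed (collapse a)) b ≡ adj G a b
  adj-recollapse a b with embed-collapse a
  ... | inj₁ (refl , a↦y) rewrite a↦y = sym (tw b)
  ... | inj₂ a↦a rewrite a↦a = refl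

  adj-collapse : ∀ a b → adj G' (collapse a) (collapse b) ≡ adj G a b
  adj-collapse a b = begin
    adj G (embed (collapse a)) (embed (collapse b)) ≡⟨ Graph.sym G _ _ ⟩
    adj G (embed (collapse b)) (embed (collapse a)) ≡⟨ adj-recollapse b _ ⟩
    adj G b (embed (collapse a))                    ≡⟨ Graph.sym G _ _ ⟩
    adj G (embed (collapse a)) b                    ≡⟨ adj-recollapse a b ⟩
    adj G a b                                       ∎
    where open ≡-Reasoning

  -- The invariant: S, a colouring of G, is the lift of T, a colouring of G'.
  -- (A record, so that S and T can be inferred from a proof of it.)
  record Lifts (S : Coloring (suc m) cmax) (T : Coloring m cmax) : Set where
    constructor lifts
    field at : ∀ v → S v ≡ T (collapse v)
  open Lifts

  lifts-restrict : ∀ {S T} → Lifts S T → ∀ i → S (embed i) ≡ T i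
  lifts-restrict {T = T} L i = trans (at L (embed i)) (cong T (collapse-embed i))

  lifts-twins : ∀ {S T} → Lifts S T → S x ≡ S y
  lifts-twins {T = T} L = trans (at L x) (trans (cong T collapse-twins) (sym (at L y)))

  restriction-lifts : ∀ {col : Coloring (suc m) cmax} → col x ≡ col y →
                      Lifts col (restrict col x)
  restriction-lifts {col} cxy = lifts lift-at
    where
      lift-at : ∀ v → col v ≡ restrict col x (collapse v)
      lift-at v with embed-collapse v
      ... | inj₁ (refl , x↦y) = trans cxy (cong col (sym x↦y))
      ... | inj₂ v↦v = cong col (sym v↦v)

  comp-embed : ∀ {S T u v} → Lifts S T → Comp G' T u v → Comp G S (embed u) (embed v)
  comp-embed L = mapReach embed (λ _ _ e → e) (lifts-restrict L)

  comp-collapse : ∀ {S T u v} → Lifts S T → Comp G S (embed u) v → Comp G' T u (collapse v)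
  comp-collapse {T = T} {u} {v} L r =
    subst (λ a → Comp G' T a (collapse v)) (collapse-embed u)
      (mapReach collapse (λ a b e → trans (adj-collapse a b) e) (sym ∘ at L) r)

  comp-uncollapse : ∀ {S T u v} → Lifts S T → embed u ≢ y →
                    Comp G' T u (collapse v) → Comp G S (embed u) v
  comp-uncollapse {S} {u = u} {v} L u≢y r with embed-collapse v
  ... | inj₁ (refl , x↦y) =
        reach-x-via-twin G tw (lifts-twins L) u≢y (subst (Comp G S (embed u)) x↦y (comp-embed L r))
  ... | inj₂ v↦v = subst (Comp G S (embed u)) v↦v (comp-embed L r)

  move-lift : ∀ {S T T' u c} → Lifts S T → embed u ≢ y →
              MoveResult G' T (u , c) T' → MoveResult G S (embed u , c) (T' ∘ collapse)
  move-lift L u≢y mr v =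
      (λ inC → proj₁ (mr (collapse v)) (comp-collapse L inC))
    , (λ ¬inC → trans (proj₂ (mr (collapse v)) (¬inC ∘ comp-uncollapse L u≢y)) (sym (at L v)))

  move-restrict : ∀ {S T S' u c} → Lifts S T →
                  MoveResult G S (embed u , c) S' → MoveResult G' T (u , c) (S' ∘ embed)
  move-restrict {S} {T} {u = u} L mr v =
      (λ inC → proj₁ (mr (embed v)) (comp-embed L inC))
    , (λ ¬inC → trans (proj₂ (mr (embed v)) (¬inC ∘ comp-collapse-embed)) (lifts-restrict L v))
    where
      comp-collapse-embed : Comp G S (embed u) (embed v) → Comp G' T u v
      comp-collapse-embed r = subst (Comp G' T u) (collapse-embed v) (comp-collapse L r)

  move-restrict-lifts : ∀ {S T S' u c} → Lifts S T → embed u ≢ y →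
                        MoveResult G S (embed u , c) S' → Lifts S' (S' ∘ embed)
  move-restrict-lifts L u≢y mr = lifts (moveResult-unique mr (move-lift L u≢y (move-restrict L mr)))

  AvoidsY : List (Move m cmax) → Set
  AvoidsY = All (λ mv → embed (proj₁ mv) ≢ y)

  seq-lift : ∀ ms {S T T''} → Lifts S T → AvoidsY ms → SeqResult G' T ms T'' →
             ∃ λ S'' → SeqResult G S (map (liftMove x) ms) S'' × Lifts S'' T''
  seq-lift [] L [] done = _ , done , L
  seq-lift (_ ∷ ms) L (u≢y ∷ avoid) (next mr sr)
    with seq-lift ms (lifts λ _ → refl) avoid sr
  ... | S'' , sr' , L'' = S'' , next (move-lift L u≢y mr) sr' , L''

  seq-restrict : ∀ ms {S T S''} → Lifts S T → AvoidsY ms →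
                 SeqResult G S (map (liftMove x) ms) S'' →
                 ∃ λ T'' → SeqResult G' T ms T'' × Lifts S'' T''
  seq-restrict [] L [] done = _ , done , L
  seq-restrict (_ ∷ ms) L (u≢y ∷ avoid) (next mr sr)
    with seq-restrict ms (move-restrict-lifts L u≢y mr) avoid sr
  ... | T'' , sr' , L'' = T'' , next (move-restrict L mr) sr' , L''

  constant-lift : ∀ {S T} → Lifts S T → Constant T → Constant S
  constant-lift L (c , k) = c , λ v → trans (at L v) (k (collapse v))

  constant-restrict : ∀ {S T} → Lifts S T → Constant S → Constant T
  constant-restrict L (c , k) = c , λ i → trans (sym (lifts-restrict L i)) (k (embed i))

lemma13 : ∀ {m cmax : ℕ} (G : Graph (suc m)) (col : Coloring (suc m) cmax)
          (x y : Fin (suc m)) → x ≢ y →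
          (∀ z → adj G x z ≡ adj G y z) → col x ≡ col y →
          (ms : List (Move m cmax)) →
          All (λ mv → punchIn x (proj₁ mv) ≢ y) ms →
          ResultsConstant G col (map (liftMove x) ms)
            ⇔ ResultsConstant (deleteVertex G x) (restrict col x) ms
lemma13 {cmax = cmax} G col x y x≢y tw cxy ms avoid = mk⇔ toDeleted fromDeleted
  where
    open Deletion {cmax = cmax} G x y x≢y tw

    toDeleted : ResultsConstant G col (map (liftMove x) ms) → ResultsConstant G' (restrict col x) ms
    toDeleted (S'' , sr , const) with seq-restrict ms (restriction-lifts cxy) avoid sr
    ... | T'' , sr' , L = T'' , sr' , constant-restrict L const

    fromDeleted : ResultsConstant G' (restrict col x) ms → ResultsConstant G col (map (liftMove x) ms)
    fromDeleted (T'' , sr , const) with seq-lift ms (restriction-lifts cxy) avoid sr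
    ... | S'' , sr' , L = S'' , sr' , constant-lift L const
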